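{- Let $d,n \ge 1$ and let $s$ be an integer with $1 + \lceil d/n \rceil \le s \le d$. Let $v \in F_s$ and let $u^1 = v, u^2, \dots, u^m$ be the labels along a directed path in the infection witness tree $\mathrm{IW}(v)$ starting at the root, with $u^i \in \mathrm{Pre}(u^{i-1})$ for all $2 \le i \le m$. Then $m \le (d+2)n^2 + n + 1$.
   Context: $[n] = \{1,\dots,n\}$, $[n]^d$ is the $d$-dimensional grid (vertices adjacent iff they differ by $1$ in exactly one coordinate), and $e_j$ is the $j$-th standard unit vector. For $d \le k \le dn$, $V_k = \{v \in [n]^d : \sum_{i=1}^d v_i = k\}$ (and $V_k=\emptyset$ otherwise). Set $F_s = \bigcup_{i=1}^{n-1} V_{(s-1)n+i}$. For $v \in F_s$ let $t_v = \sum_{i=1}^d v_i - (s-1)n$ and $\mathrm{Pre}(v) = \{v + e_j : v_j \le t_v\} \cup \{v - e_j : v_j > t_v\}$ (a set of $d$ vertices of $[n]^d$). The infection witness tree $\mathrm{IW}(v)$ is the directed rooted $d$-ary tree, edges directed away from the root, with vertices labelled by elements of $F_s \cup V_{(s-1)n} \cup V_{sn}$ (labels may repeat), built as follows: the root is labelled $v$ and declared active; repeatedly an active tree vertex is selected; if its label $u$ lies in $V_{(s-1)n} \cup V_{sn}$ it becomes a leaf and is made inactive; if $u \in F_s$ it is given $d$ active children labelled by the elements of $\mathrm{Pre}(u)$, and is made inactive. -}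

module Defs where

open import Data.Nat using (ℕ; zero; suc; _+_; _*_; _∸_; _≤_; _<_; pred)
open import Data.Nat.DivMod using (_/_)
open import Data.Fin using (Fin)
open import Data.Vec using (Vec; lookup; sum; updateAt)
open import Data.Product using (_×_; Σ; ∃)
open import Data.Sum using (_⊎_)
open import Relation.Binary.PropositionalEquality using (_≡_)

-- A point of ℤ^d with natural coordinates; [n]^d membership is `InGrid`.
Point : ℕ → Set
Point d = Vec ℕ d

InGrid : ∀ {d} → ℕ → Point d → Set
InGrid n v = ∀ i → 1 ≤ lookup v i × lookup v i ≤ n

-- ceiling division ⌈ a / b ⌉ (b ≥ 1; value for b = 0 irrelevant)
⌈_/_⌉ : ℕ → ℕ → ℕ
⌈ a / zero ⌉ = 0
⌈ a / suc k ⌉ = (a + k) / suc k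

-- v ∈ F_s = ⋃_{i=1}^{n-1} V_{(s-1)n+i}
InF : ∀ {d} → ℕ → ℕ → Point d → Set
InF n s v = InGrid n v
          × (s ∸ 1) * n + 1 ≤ sum v
          × sum v ≤ (s ∸ 1) * n + (n ∸ 1)

-- t_v = Σ v_i − (s−1)n  (well defined as a natural number for v ∈ F_s)
t : ∀ {d} → ℕ → ℕ → Point d → ℕ
t n s v = sum v ∸ (s ∸ 1) * n

_+e_ : ∀ {d} → Point d → Fin d → Point d
v +e j = updateAt v j suc

_-e_ : ∀ {d} → Point d → Fin d → Point d
v -e j = updateAt v j pred

Pre : ∀ {d} → ℕ → ℕ → Point d → Point d → Set
Pre n s u w = ∃ λ j → (lookup u j ≤ t n s u × w ≡ u +e j)
                    ⊎ (t n s u < lookup u j × w ≡ u -e j)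

-- The labels u¹ … uᵐ (indices 1..m of u) of a directed path in IW(v)
-- starting at the root: u¹ = v, and for 2 ≤ i ≤ m the tree vertex labelled
-- u^{i-1} has children (i.e. u^{i-1} ∈ F_s) and u^i ∈ Pre(u^{i-1}).
IWPath : ∀ {d} → ℕ → ℕ → Point d → ℕ → (ℕ → Point d) → Set
IWPath n s v m u =
  1 ≤ m × u 1 ≡ v ×
  (∀ i → 2 ≤ i → i ≤ m → InF n s (u (i ∸ 1)) × Pre n s (u (i ∸ 1)) (u i))

-- Along a path of IW(v) the potential Φ(u) = Σ uᵢ² − t_u (t_u + 1) strictly decreases:
-- raising a coordinate c ≤ t_u by one changes Φ by (2c + 1) − 2(t_u + 1) < 0, and
-- lowering a coordinate c > t_u changes it by 2t_u − (2c − 1) < 0.  On F_s we have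
-- 0 ≤ t_u ≤ n − 1 and Σ uᵢ² ≤ d n², so Φ ranges over [−n², d n²] and at most
-- (d + 1) n² + 1 vertices of the path lie in F_s.
module Submission where

open import Defs
open import Data.Nat using (ℕ; zero; suc; _+_; _*_; _∸_; _≤_; _<_; z≤n; s≤s; pred)
open import Data.Nat.Properties
open import Data.Nat.Tactic.RingSolver using (solve-∀)
import Data.Fin as Fin
open import Data.Vec using (Vec; []; _∷_; lookup; sum; map; updateAt)
open import Data.Vec.Properties using (updateAt-updateAt-local; updateAt-id; lookup∘updateAt)
open import Function using (_∘_)
open import Data.Product using (_,_; proj₁; proj₂)
open import Data.Sum using (inj₁; inj₂)
open import Relation.Binary.PropositionalEquality

square : ℕ → ℕ
square x = x * x

pronic : ℕ → ℕ
pronic x = x * x + x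

sumSquares : ∀ {d} → Vec ℕ d → ℕ
sumSquares v = sum (map square v)

excess : ∀ {d} → ℕ → Point d → ℕ
excess K v = sum v ∸ K

-- Φ_K(w) < Φ_K(u) for Φ_K(v) = sumSquares v − pronic (excess K v), without subtraction.
Drops : ∀ {d} → ℕ → Point d → Point d → Set
Drops K u w = sumSquares w + pronic (excess K u) + 1 ≤ sumSquares u + pronic (excess K w)

square-suc : ∀ c → suc c * suc c ≡ c * c + (c + c + 1)
square-suc = solve-∀

pronic-suc : ∀ x → suc x * suc x + suc x ≡ x * x + x + (x + x + 2)
pronic-suc = solve-∀

square-pronic-below : ∀ {c x} → c ≤ x → square (suc c) + pronic x + 1 ≤ square c + pronic (suc x)
square-pronic-below {c} {x} c≤x = begin
  square (suc c) + pronic x + 1           ≡⟨ cong (λ y → y + pronic x + 1) (square-suc c) ⟩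
  square c + (c + c + 1) + pronic x + 1   ≡⟨ rearrange (square c) c (pronic x) ⟩
  square c + pronic x + (c + c + 2)       ≤⟨ +-monoʳ-≤ (square c + pronic x) (+-monoˡ-≤ 2 (+-mono-≤ c≤x c≤x)) ⟩
  square c + pronic x + (x + x + 2)       ≡⟨ +-assoc (square c) _ _ ⟩
  square c + (pronic x + (x + x + 2))     ≡⟨ cong (square c +_) (pronic-suc x) ⟨
  square c + pronic (suc x)               ∎
  where
  open ≤-Reasoning
  rearrange : ∀ a c p → a + (c + c + 1) + p + 1 ≡ a + p + (c + c + 2)
  rearrange = solve-∀

square-pronic-above : ∀ {c x} → x < c → square c + pronic (suc x) + 1 ≤ square (suc c) + pronic x
square-pronic-above {c} {x} x<c = begin
  square c + pronic (suc x) + 1                 ≡⟨ cong (λ y → square c + y + 1) (pronic-suc x) ⟩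
  square c + (pronic x + (x + x + 2)) + 1       ≡⟨ rearrange (square c) (pronic x) x ⟩
  square c + pronic x + (suc x + suc x + 1)     ≤⟨ +-monoʳ-≤ (square c + pronic x) (+-monoˡ-≤ 1 (+-mono-≤ x<c x<c)) ⟩
  square c + pronic x + (c + c + 1)             ≡⟨ +-comm (square c + pronic x) _ ⟩
  (c + c + 1) + (square c + pronic x)           ≡⟨ +-assoc (c + c + 1) (square c) _ ⟨
  (c + c + 1) + square c + pronic x             ≡⟨ cong (_+ pronic x) (trans (+-comm _ (square c)) (sym (square-suc c))) ⟩
  square (suc c) + pronic x                     ∎
  where
  open ≤-Reasoning
  rearrange : ∀ a p x → a + (p + (x + x + 2)) + 1 ≡ a + p + (suc x + suc x + 1)
  rearrange = solve-∀

transfer : ∀ {S S′ x y P P′} → S′ + x ≡ S + y → y + P + 1 ≤ x + P′ → S′ + P + 1 ≤ S + P′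
transfer {S} {S′} {x} {y} {P} {P′} balance ineq = +-cancelʳ-≤ x _ _ (begin
  S′ + P + 1 + x     ≡⟨ rearrange₁ S′ P x ⟩
  (S′ + x) + (P + 1) ≡⟨ cong (_+ (P + 1)) balance ⟩
  (S + y) + (P + 1)  ≡⟨ rearrange₂ S y P ⟩
  S + (y + P + 1)    ≤⟨ +-monoʳ-≤ S ineq ⟩
  S + (x + P′)       ≡⟨ rearrange₃ S x P′ ⟩
  S + P′ + x         ∎)
  where
  open ≤-Reasoning
  rearrange₁ : ∀ a p x → a + p + 1 + x ≡ (a + x) + (p + 1)
  rearrange₁ = solve-∀
  rearrange₂ : ∀ a y p → (a + y) + (p + 1) ≡ a + (y + p + 1)
  rearrange₂ = solve-∀
  rearrange₃ : ∀ a x p → a + (x + p) ≡ a + p + x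
  rearrange₃ = solve-∀

telescope : ∀ (a b : ℕ → ℕ) k → (∀ i → i < k → a (suc i) + b i + 1 ≤ a i + b (suc i)) →
            a k + b 0 + k ≤ a 0 + b k
telescope a b zero _ = ≤-reflexive (+-identityʳ _)
telescope a b (suc k) steps = +-cancelʳ-≤ (a k + b k) _ _ (begin
  a (suc k) + b 0 + suc k + (a k + b k)              ≡⟨ rearrange₁ (a (suc k)) (b 0) k (a k) (b k) ⟩
  (a (suc k) + b k + 1) + (a k + b 0 + k)            ≤⟨ +-mono-≤ (steps k ≤-refl) (telescope a b k (λ i i<k → steps i (m≤n⇒m≤1+n i<k))) ⟩
  (a k + b (suc k)) + (a 0 + b k)                    ≡⟨ rearrange₂ (a k) (b (suc k)) (a 0) (b k) ⟩
  a 0 + b (suc k) + (a k + b k)                      ∎)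
  where
  open ≤-Reasoning
  rearrange₁ : ∀ a′ b₀ k a b → a′ + b₀ + suc k + (a + b) ≡ (a′ + b + 1) + (a + b₀ + k)
  rearrange₁ = solve-∀
  rearrange₂ : ∀ a b′ a₀ b → (a + b′) + (a₀ + b) ≡ a₀ + b′ + (a + b)
  rearrange₂ = solve-∀

sum-map-updateAt : ∀ {d} (g : ℕ → ℕ) (v : Vec ℕ d) j f →
                   sum (map g (updateAt v j f)) + g (lookup v j) ≡ sum (map g v) + g (f (lookup v j))
sum-map-updateAt g (x ∷ v) Fin.zero f = swap (g x) (g (f x)) (sum (map g v))
  where
  swap : ∀ a b c → b + c + a ≡ a + c + b
  swap = solve-∀
sum-map-updateAt g (x ∷ v) (Fin.suc j) f = begin
  g x + sum (map g (updateAt v j f)) + g (lookup v j)   ≡⟨ +-assoc (g x) _ _ ⟩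
  g x + (sum (map g (updateAt v j f)) + g (lookup v j)) ≡⟨ cong (g x +_) (sum-map-updateAt g v j f) ⟩
  g x + (sum (map g v) + g (f (lookup v j)))            ≡⟨ +-assoc (g x) _ _ ⟨
  g x + sum (map g v) + g (f (lookup v j))              ∎
  where open ≡-Reasoning

sumSquares-updateAt : ∀ {d} (v : Vec ℕ d) j f →
                      sumSquares (updateAt v j f) + square (lookup v j) ≡ sumSquares v + square (f (lookup v j))
sumSquares-updateAt = sum-map-updateAt square

sum-+e : ∀ {d} (v : Point d) j → sum (v +e j) ≡ suc (sum v)
sum-+e (x ∷ v) Fin.zero = refl
sum-+e (x ∷ v) (Fin.suc j) = trans (cong (x +_) (sum-+e v j)) (+-suc x (sum v))

excess-+e : ∀ {d} K (v : Point d) j → K ≤ sum v → excess K (v +e j) ≡ suc (excess K v)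
excess-+e K v j K≤sum = trans (cong (_∸ K) (sum-+e v j)) (+-∸-assoc 1 K≤sum)

-e-+e : ∀ {d} (v : Point d) j {c} → lookup v j ≡ suc c → (v -e j) +e j ≡ v
-e-+e v j eq = trans (updateAt-updateAt-local j v (sym eq′)) (updateAt-id j v)
  where
  eq′ : lookup v j ≡ suc (pred (lookup v j))
  eq′ = trans eq (cong (suc ∘ pred) (sym eq))

drops-+e : ∀ {d} K (v : Point d) j → K ≤ sum v → lookup v j ≤ excess K v → Drops K v (v +e j)
drops-+e K v j K≤sum c≤x rewrite excess-+e K v j K≤sum =
  transfer {S′ = sumSquares (v +e j)} (sumSquares-updateAt v j suc) (square-pronic-below c≤x)

drops-+e⁻ : ∀ {d} K (v : Point d) j → K ≤ sum v → excess K v < lookup v j → Drops K (v +e j) v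
drops-+e⁻ K v j K≤sum x<c rewrite excess-+e K v j K≤sum =
  transfer {S′ = sumSquares v} (sym (sumSquares-updateAt v j suc)) (square-pronic-above x<c)

-- Stepping down from u is stepping up from u -e j, read backwards.
drops--e : ∀ {d} K (u : Point d) j → K < sum u → excess K u < lookup u j → Drops K u (u -e j)
drops--e K u j K<sum x<c with lookup u j in eq | x<c
... | suc b | x<suc-b = subst (λ z → Drops K z v) u≡v+e (drops-+e⁻ K v j K≤sum-v x<b)
  where
  v : Point _
  v = u -e j
  u≡v+e : v +e j ≡ u
  u≡v+e = -e-+e u j eq
  K≤sum-v : K ≤ sum v
  K≤sum-v = ≤-pred (subst (K <_) (trans (cong sum (sym u≡v+e)) (sum-+e v j)) K<sum)
  lookup-v : lookup v j ≡ b
  lookup-v = trans (lookup∘updateAt j u) (cong pred eq)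
  excess-u : excess K u ≡ suc (excess K v)
  excess-u = trans (cong (excess K) (sym u≡v+e)) (excess-+e K v j K≤sum-v)
  x<b : excess K v < lookup v j
  x<b = subst (excess K v <_) (sym lookup-v) (≤-pred (subst (_< suc b) excess-u x<suc-b))

pre-drops : ∀ {d} n s (u w : Point d) → (s ∸ 1) * n < sum u → Pre n s u w → Drops ((s ∸ 1) * n) u w
pre-drops n s u _ K<sum (j , inj₁ (c≤x , refl)) = drops-+e _ u j (<⇒≤ K<sum) c≤x
pre-drops n s u _ K<sum (j , inj₂ (x<c , refl)) = drops--e _ u j K<sum x<c

sumSquares-≤ : ∀ {d} n (v : Point d) → InGrid n v → sumSquares v ≤ d * square n
sumSquares-≤ n [] _ = z≤n
sumSquares-≤ n (x ∷ v) inGrid = +-mono-≤ (*-mono-≤ x≤n x≤n) (sumSquares-≤ n v (inGrid ∘ Fin.suc))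
  where
  x≤n : x ≤ n
  x≤n = proj₂ (inGrid Fin.zero)

pronic-≤ : ∀ n {x} → x ≤ n ∸ 1 → pronic x ≤ square n
pronic-≤ zero z≤n = z≤n
pronic-≤ (suc n) {x} x≤n = begin
  x * x + x             ≤⟨ +-mono-≤ (*-mono-≤ x≤n x≤n) x≤n ⟩
  n * n + n             ≤⟨ m≤m+n (n * n + n) (suc n) ⟩
  n * n + n + suc n     ≡⟨ expand n ⟨
  suc n * suc n         ∎
  where
  open ≤-Reasoning
  expand : ∀ n → suc n * suc n ≡ n * n + n + suc n
  expand = solve-∀

excess-≤ : ∀ {d} n s (w : Point d) → InF n s w → excess ((s ∸ 1) * n) w ≤ n ∸ 1
excess-≤ n s w (_ , _ , sum≤) = m≤n+o⇒m∸n≤o (sum w) ((s ∸ 1) * n) sum≤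

-- The last vertex need not lie in F_s, so only the first k of the k + 1 edges are used.
iwPath-steps-≤ : ∀ {d} n s (v : Point d) k u → IWPath n s v (suc (suc k)) u → k ≤ d * square n + square n
iwPath-steps-≤ {d} n s v k u (_ , _ , edges) = begin
  k                    ≤⟨ m≤n+m k (a k + b 0) ⟩
  a k + b 0 + k        ≤⟨ telescope a b k (λ i i<k → drop i (m≤n⇒m≤1+n i<k)) ⟩
  a 0 + b k            ≤⟨ +-mono-≤ (sumSquares-≤ n (u 1) (proj₁ (inF 0 z≤n)))
                                   (pronic-≤ n (excess-≤ n s (u (suc k)) (inF k ≤-refl))) ⟩
  d * square n + square n
    ∎
  where
  open ≤-Reasoning
  K : ℕ
  K = (s ∸ 1) * n
  a b : ℕ → ℕ
  a i = sumSquares (u (suc i))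
  b i = pronic (excess K (u (suc i)))
  inF : ∀ i → i ≤ k → InF n s (u (suc i))
  inF i i≤k = proj₁ (edges (suc (suc i)) (s≤s (s≤s z≤n)) (s≤s (s≤s i≤k)))
  drop : ∀ i → i < suc k → Drops K (u (suc i)) (u (suc (suc i)))
  drop i i<k with edges (suc (suc i)) (s≤s (s≤s z≤n)) (s≤s i<k)
  ... | (_ , K+1≤sum , _) , pre = pre-drops n s _ _ (subst (_≤ sum (u (suc i))) (+-comm K 1) K+1≤sum) pre

length-bound : ∀ d n k → 1 ≤ n → k ≤ d * square n + square n → suc (suc k) ≤ (d + 2) * (n * n) + n + 1
length-bound d n k 1≤n k≤ = begin
  suc (suc k)                                    ≡⟨ +-comm 2 k ⟩
  k + 2                                          ≤⟨ +-monoˡ-≤ 2 k≤ ⟩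
  d * square n + square n + 2                    ≤⟨ +-monoʳ-≤ (d * square n + square n) (s≤s 1≤n²+n) ⟩
  d * square n + square n + (1 + (square n + n)) ≡⟨ collect d n ⟩
  (d + 2) * (n * n) + n + 1                      ∎
  where
  open ≤-Reasoning
  1≤n²+n : 1 ≤ square n + n
  1≤n²+n = ≤-trans 1≤n (m≤n+m n (square n))
  collect : ∀ d n → d * (n * n) + n * n + (1 + (n * n + n)) ≡ (d + 2) * (n * n) + n + 1
  collect = solve-∀

lemma5 : (d n s : ℕ) → 1 ≤ d → 1 ≤ n →
         1 + ⌈ d / n ⌉ ≤ s → s ≤ d →
         (v : Point d) → InF n s v →
         (m : ℕ) (u : ℕ → Point d) → IWPath n s v m u →
         m ≤ (d + 2) * (n * n) + n + 1
lemma5 d n s _ 1≤n _ _ v _ zero u (() , _)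
lemma5 d n s _ 1≤n _ _ v _ (suc zero) u _ = m≤n+m 1 _
lemma5 d n s _ 1≤n _ _ v _ (suc (suc k)) u path = length-bound d n k 1≤n (iwPath-steps-≤ n s v k u path)
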